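{- Let $\mu,\tau\in\mathcal P^+$ and integers $1\le s<k$. Suppose $(\lambda_1,\dots,\lambda_s)\triangleleft(\mu_1,\dots,\mu_s)$ in $\mathcal P^+(\mu,s)$ and $(\tau_1,\dots,\tau_{k-s})\in\mathcal P^+(\tau,k-s)$. Then $$(\lambda_1,\dots,\lambda_s,\tau_1,\dots,\tau_{k-s})\triangleleft(\mu_1,\dots,\mu_s,\tau_1,\dots,\tau_{k-s})\quad\text{in }\mathcal P^+(\mu+\tau,k).$$
   Context: $\mathcal P^+=\mathbb Z_{\ge0}^n$ with standard basis $\omega_i$ and coordinate functionals $\omega_i^*$. For $\nu\in\mathcal P^+$ and $m\ge1$, $\mathcal P^+(\nu,m)$ is the set of $m$-tuples of elements of $\mathcal P^+$ summing to $\nu$. For $1\le i\le j\le n$, $1\le\ell\le m$, $r_{(i,j),\ell}(\boldsymbol\lambda)=\min\{\sum_{t=i}^j\omega_t^*(\lambda_{n_1}+\dots+\lambda_{n_\ell}):1\le n_1<\dots<n_\ell\le m\}$. $\boldsymbol\lambda\trianglelefteq\boldsymbol\mu$ iff $r_{(i,j),\ell}(\boldsymbol\lambda)\le r_{(i,j),\ell}(\boldsymbol\mu)$ for all $i\le j$ and $\ell$; $\boldsymbol\lambda\sim\boldsymbol\mu$ iff all these are equal; and $\boldsymbol\lambda\triangleleft\boldsymbol\mu$ means $\boldsymbol\lambda\trianglelefteq\boldsymbol\mu$ and not $\boldsymbol\lambda\sim\boldsymbol\mu$. -}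

module Defs where

open import Data.Nat using (ℕ; zero; suc; _+_; _≤_; _<_; _⊓_)
open import Data.Fin using (Fin) renaming (_≤_ to _≤ᶠ_)
open import Data.Fin.Subset using (Subset; inside; outside; ∣_∣)
open import Data.Vec using (Vec; []; _∷_; replicate; zipWith; lookup; foldr; allFin; toList)
open import Data.List using (List; []; _∷_; map; _++_; filter)
open import Data.Nat.ListAction using (sum)
open import Relation.Nullary.Decidable using (_×-dec_)
open import Data.Bool using (Bool; true; false)
open import Data.Product using (_×_)
open import Relation.Binary.PropositionalEquality using (_≡_)
open import Relation.Nullary using (¬_)
open import Relation.Nullary.Decidable using (⌊_⌋)
import Data.Nat as ℕ
import Data.Fin as F

-- A dominant weight in P⁺ = ℤ≥0ⁿ, as a vector of its coordinates ω_i^*.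
Weight : ℕ → Set
Weight n = Vec ℕ n

Tuple : ℕ → ℕ → Set
Tuple n m = Vec (Weight n) m

_⊕_ : ∀ {n} → Weight n → Weight n → Weight n
_⊕_ = zipWith _+_

0w : ∀ {n} → Weight n
0w = replicate _ 0

tsum : ∀ {n m} → Tuple n m → Weight n
tsum = foldr _ _⊕_ 0w

InP : ∀ {n m} → Weight n → Tuple n m → Set
InP ν λs = tsum λs ≡ ν

subsets : (m : ℕ) → List (Subset m)
subsets zero = [] ∷ []
subsets (suc m) = map (inside ∷_) (subsets m) ++ map (outside ∷_) (subsets m)

subsetsOfSize : (m ℓ : ℕ) → List (Subset m)
subsetsOfSize m ℓ = filter (λ p → ∣ p ∣ ℕ.≟ ℓ) (subsets m)

subsetSum : ∀ {n m} → Subset m → Tuple n m → Weight n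
subsetSum [] [] = 0w
subsetSum (inside ∷ p) (x ∷ xs) = x ⊕ subsetSum p xs
subsetSum (outside ∷ p) (x ∷ xs) = subsetSum p xs

segSum : ∀ {n} → Fin n → Fin n → Weight n → ℕ
segSum i j v = sum (map (lookup v) (filter (λ t → (i F.≤? t) ×-dec (t F.≤? j)) (toList (allFin _))))

-- minimum of a nonempty list (the empty case never occurs for 1 ≤ ℓ ≤ m)
minimum : List ℕ → ℕ
minimum [] = 0
minimum (x ∷ []) = x
minimum (x ∷ y ∷ xs) = x ⊓ minimum (y ∷ xs)

r : ∀ {n m} → Fin n → Fin n → ℕ → Tuple n m → ℕ
r {m = m} i j ℓ λs = minimum (map (λ p → segSum i j (subsetSum p λs)) (subsetsOfSize m ℓ))

_⊴_ : ∀ {n m} → Tuple n m → Tuple n m → Set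
_⊴_ {n} {m} λs μs = (i j : Fin n) → i ≤ᶠ j → (ℓ : ℕ) → 1 ≤ ℓ → ℓ ≤ m → r i j ℓ λs ≤ r i j ℓ μs

_∼_ : ∀ {n m} → Tuple n m → Tuple n m → Set
_∼_ {n} {m} λs μs = (i j : Fin n) → i ≤ᶠ j → (ℓ : ℕ) → 1 ≤ ℓ → ℓ ≤ m → r i j ℓ λs ≡ r i j ℓ μs

_◁_ : ∀ {n m} → Tuple n m → Tuple n m → Set
λs ◁ μs = λs ⊴ μs × ¬ (λs ∼ μs)

-- For fixed i ≤ j, replacing each weight by its segment sum Σ_{t=i}^{j} ω_t^* turns r_{(i,j),ℓ}
-- into the sum of the ℓ smallest entries of a vector of naturals, so both claims concern such
-- "minimal ℓ-sums". Dominance survives appending τ because a minimising subset of the long tuple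
-- splits into a part in the first s places, which can only get cheaper, and the rest. For
-- strictness, let S be a minimising ℓ-subset of the μ-values and p its largest entry; S together
-- with the τ-places of value ≤ p minimises sums of its size for μ ++ τ (a threshold set: nothing
-- inside exceeds p and nothing outside is below p). If λ ++ τ ∼ μ ++ τ, the same τ-places give
-- r_ℓ(μ) ≤ r_ℓ(λ), and symmetrically, so λ ∼ μ.
module Submission where

open import Defs
open import Data.Nat using (ℕ; _≤_; _<_; _∸_; _+_)
open import Data.Vec using (_++_)
open import Data.Product using (_×_)

open import Data.Fin using (Fin; zero; suc) renaming (_≤?_ to _≤ᶠ?_)
open import Data.Fin.Subset using (Subset; inside; outside; ∣_∣; ⊥)
open import Data.Fin.Subset.Properties using (∣p∣≤n; ∣⊥∣≡0)
open import Data.List using (List; []; _∷_; map; filter)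
open import Data.List.Membership.Propositional using (_∈_)
open import Data.List.Membership.Propositional.Properties
  using (∈-filter⁺; ∈-filter⁻; ∈-++⁺ˡ; ∈-++⁺ʳ; ∈-map⁺)
open import Data.List.Properties using (map-cong)
open import Data.List.Relation.Unary.Any using (here; there)
open import Data.Nat using (zero; suc; _*_; _⊓_; _⊔_; z≤n; s≤s; _≤?_; _≟_)
open import Data.Nat.ListAction using (sum)
open import Data.Nat.Properties
open import Data.Nat.Tactic.RingSolver using (solve-∀)
open import Data.Product using (Σ-syntax; ∃-syntax; _,_; proj₂)
open import Data.Sum using (inj₁; inj₂)
open import Data.Vec using (Vec; []; _∷_; lookup; splitAt; _[_]≔_; toList; allFin) renaming (map to vmap)
open import Data.Vec.Properties
  using (lookup-zipWith; lookup-replicate; lookup∘update′; []≔-lookup; map-++; zipWith-identityˡ; zipWith-assoc)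
open import Function using (_∘_)
open import Relation.Binary.PropositionalEquality
open import Relation.Nullary using (yes; no)
open import Relation.Nullary.Decidable using (_×-dec_)

open import Algebra.Properties.CommutativeSemigroup +-commutativeSemigroup using (interchange)

private
  variable
    m n s t ℓ : ℕ

module _ {A : Set} (f : A → ℕ) where

  minimum-map-≤ : ∀ {xs : List A} {x} → x ∈ xs → minimum (map f xs) ≤ f x
  minimum-map-≤ {_ ∷ []}    (here refl) = ≤-refl
  minimum-map-≤ {_ ∷ _ ∷ _} (here refl) = m⊓n≤m _ _
  minimum-map-≤ {_ ∷ _ ∷ _} (there x∈) = ≤-trans (m⊓n≤n _ _) (minimum-map-≤ x∈)

  minimum-map-attained : ∀ {xs : List A} {x} → x ∈ xs →
    ∃[ y ] y ∈ xs × minimum (map f xs) ≡ f y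
  minimum-map-attained {x ∷ []}     _ = x , here refl , refl
  minimum-map-attained {x ∷ y ∷ xs} _ with minimum-map-attained {y ∷ xs} (here refl)
  ... | z , z∈ , eq with ⊓-sel (f x) (minimum (map f (y ∷ xs)))
  ... | inj₁ e = x , here refl , e
  ... | inj₂ e = z , there z∈ , trans e eq

∈-subsets : (p : Subset m) → p ∈ subsets m
∈-subsets []            = here refl
∈-subsets (inside ∷ p)  = ∈-++⁺ˡ (∈-map⁺ (inside ∷_) (∈-subsets p))
∈-subsets {suc m} (outside ∷ p) =
  ∈-++⁺ʳ (map (inside ∷_) (subsets m)) (∈-map⁺ (outside ∷_) (∈-subsets p))

∈-subsetsOfSize⁺ : (p : Subset m) → ∣ p ∣ ≡ ℓ → p ∈ subsetsOfSize m ℓ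
∈-subsetsOfSize⁺ {ℓ = ℓ} p = ∈-filter⁺ (λ q → ∣ q ∣ ≟ ℓ) (∈-subsets p)

∈-subsetsOfSize⁻ : {p : Subset m} → p ∈ subsetsOfSize m ℓ → ∣ p ∣ ≡ ℓ
∈-subsetsOfSize⁻ {m} {ℓ} p∈ = proj₂ (∈-filter⁻ (λ q → ∣ q ∣ ≟ ℓ) {xs = subsets m} p∈)

subsetOfSize : ℓ ≤ m → Σ[ p ∈ Subset m ] ∣ p ∣ ≡ ℓ
subsetOfSize {zero}  {m}     _         = ⊥ , ∣⊥∣≡0 m
subsetOfSize {suc ℓ} {suc m} (s≤s ℓ≤m) with subsetOfSize ℓ≤m
... | p , |p| = inside ∷ p , cong suc |p|

∣p++q∣ : (p : Subset m) (q : Subset n) → ∣ p ++ q ∣ ≡ ∣ p ∣ + ∣ q ∣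
∣p++q∣ []            q = refl
∣p++q∣ (inside ∷ p)  q = cong suc (∣p++q∣ p q)
∣p++q∣ (outside ∷ p) q = ∣p++q∣ p q

∣++∣-congʳ : (p p′ : Subset m) (q : Subset n) → ∣ p ∣ ≡ ∣ p′ ∣ → ∣ p ++ q ∣ ≡ ∣ p′ ++ q ∣
∣++∣-congʳ p p′ q eq = trans (∣p++q∣ p q) (trans (cong (_+ ∣ q ∣) eq) (sym (∣p++q∣ p′ q)))

sumOver : Subset m → Vec ℕ m → ℕ
sumOver []            []      = 0
sumOver (inside ∷ p)  (x ∷ v) = x + sumOver p v
sumOver (outside ∷ p) (x ∷ v) = sumOver p v

sumOver-⊥ : (v : Vec ℕ m) → sumOver ⊥ v ≡ 0
sumOver-⊥ []      = refl
sumOver-⊥ (_ ∷ v) = sumOver-⊥ v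

sumOver-++ : (p : Subset m) (q : Subset n) (u : Vec ℕ m) (w : Vec ℕ n) →
  sumOver (p ++ q) (u ++ w) ≡ sumOver p u + sumOver q w
sumOver-++ []            q []      w = refl
sumOver-++ (inside ∷ p)  q (x ∷ u) w = trans (cong (x +_) (sumOver-++ p q u w)) (sym (+-assoc x _ _))
sumOver-++ (outside ∷ p) q (x ∷ u) w = sumOver-++ p q u w

minSum : ℕ → Vec ℕ m → ℕ
minSum {m} ℓ v = minimum (map (λ p → sumOver p v) (subsetsOfSize m ℓ))

minSum-≤ : (p : Subset m) (v : Vec ℕ m) → ∣ p ∣ ≡ ℓ → minSum ℓ v ≤ sumOver p v
minSum-≤ p v |p| = minimum-map-≤ (λ q → sumOver q v) (∈-subsetsOfSize⁺ p |p|)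

minSum-attained : (v : Vec ℕ m) → ℓ ≤ m → Σ[ p ∈ Subset m ] ∣ p ∣ ≡ ℓ × minSum ℓ v ≡ sumOver p v
minSum-attained v ℓ≤m with subsetOfSize ℓ≤m
... | p₀ , |p₀| with minimum-map-attained (λ q → sumOver q v) (∈-subsetsOfSize⁺ p₀ |p₀|)
... | p , p∈ , eq = p , ∈-subsetsOfSize⁻ p∈ , eq

minSum-zero : (v : Vec ℕ m) → minSum 0 v ≡ 0
minSum-zero {m} v = n≤0⇒n≡0 (subst (minSum 0 v ≤_) (sumOver-⊥ v) (minSum-≤ ⊥ v (∣⊥∣≡0 m)))

Minimal : Vec ℕ m → Subset m → Set
Minimal v S = ∀ T → ∣ T ∣ ≡ ∣ S ∣ → sumOver S v ≤ sumOver T v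

minimal-ofSize : (v : Vec ℕ m) → ℓ ≤ m → Σ[ S ∈ Subset m ] ∣ S ∣ ≡ ℓ × Minimal v S
minimal-ofSize v ℓ≤m with minSum-attained v ℓ≤m
... | S , |S| , eq = S , |S| , λ T |T| → subst (_≤ sumOver T v) eq (minSum-≤ T v (trans |T| |S|))

minimal⇒minSum : {v : Vec ℕ m} (S : Subset m) → Minimal v S → minSum ∣ S ∣ v ≡ sumOver S v
minimal⇒minSum {v = v} S min with minSum-attained v (∣p∣≤n S)
... | T , |T| , eq = ≤-antisym (minSum-≤ S v refl) (subst (sumOver S v ≤_) (sym eq) (min T |T|))

data Threshold (p : ℕ) : Subset m → Vec ℕ m → Set where
  []    : Threshold p [] []
  below : ∀ {x} {W : Subset m} {v} → x ≤ p → Threshold p W v → Threshold p (inside ∷ W) (x ∷ v)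
  above : ∀ {x} {W : Subset m} {v} → p ≤ x → Threshold p W v → Threshold p (outside ∷ W) (x ∷ v)

lookup⇒threshold : ∀ {p} {W : Subset m} {v} →
  (∀ t → lookup W t ≡ inside → lookup v t ≤ p) →
  (∀ t → lookup W t ≡ outside → p ≤ lookup v t) → Threshold p W v
lookup⇒threshold {W = []}          {[]}    _   _   = []
lookup⇒threshold {W = inside ∷ W}  {_ ∷ _} low high =
  below (low zero refl) (lookup⇒threshold (low ∘ suc) (high ∘ suc))
lookup⇒threshold {W = outside ∷ W} {_ ∷ _} low high =
  above (high zero refl) (lookup⇒threshold (low ∘ suc) (high ∘ suc))

threshold-++ : ∀ {p} {S : Subset m} {U : Subset n} {y z} →
  Threshold p S y → Threshold p U z → Threshold p (S ++ U) (y ++ z)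
threshold-++ []               thU = thU
threshold-++ (below x≤p thS)  thU = below x≤p (threshold-++ thS thU)
threshold-++ (above p≤x thS)  thU = above p≤x (threshold-++ thS thU)

atMost : ℕ → Vec ℕ m → Subset m
atMost p []      = []
atMost p (x ∷ v) with x ≤? p
... | yes _ = inside ∷ atMost p v
... | no  _ = outside ∷ atMost p v

threshold-atMost : ∀ p (v : Vec ℕ m) → Threshold p (atMost p v) v
threshold-atMost p []      = []
threshold-atMost p (x ∷ v) with x ≤? p
... | yes x≤p = below x≤p (threshold-atMost p v)
... | no  x≰p = above (<⇒≤ (≰⇒> x≰p)) (threshold-atMost p v)

cappedSum : ℕ → Vec ℕ m → ℕ
cappedSum p []      = 0
cappedSum p (x ∷ v) = x ⊓ p + cappedSum p v

padded : ℕ → Subset m → Vec ℕ m → ℕ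
padded p []            []      = 0
padded p (inside ∷ W)  (x ∷ v) = x + padded p W v
padded p (outside ∷ W) (x ∷ v) = p + padded p W v

cappedSum≤padded : ∀ p (W : Subset m) v → cappedSum p v ≤ padded p W v
cappedSum≤padded p []            []      = z≤n
cappedSum≤padded p (inside ∷ W)  (x ∷ v) = +-mono-≤ (m⊓n≤m x p) (cappedSum≤padded p W v)
cappedSum≤padded p (outside ∷ W) (x ∷ v) = +-mono-≤ (m⊓n≤n x p) (cappedSum≤padded p W v)

threshold⇒padded≡cappedSum : ∀ {p} {W : Subset m} {v} → Threshold p W v → padded p W v ≡ cappedSum p v
threshold⇒padded≡cappedSum []              = refl
threshold⇒padded≡cappedSum (below x≤p thW) =
  cong₂ _+_ (sym (m≤n⇒m⊓n≡m x≤p)) (threshold⇒padded≡cappedSum thW)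
threshold⇒padded≡cappedSum (above p≤x thW) =
  cong₂ _+_ (sym (m≥n⇒m⊓n≡n p≤x)) (threshold⇒padded≡cappedSum thW)

padded-+-* : ∀ p (W : Subset m) v → padded p W v + p * ∣ W ∣ ≡ sumOver W v + p * m
padded-+-* p []            []      = refl
padded-+-* p (inside ∷ W)  (x ∷ v) = begin
  (x + padded p W v) + p * suc ∣ W ∣      ≡⟨ shift x _ p ∣ W ∣ ⟩
  (x + p) + (padded p W v + p * ∣ W ∣)    ≡⟨ cong ((x + p) +_) (padded-+-* p W v) ⟩
  (x + p) + (sumOver W v + p * _)         ≡⟨ sym (shift x _ p _) ⟩
  (x + sumOver W v) + p * suc _           ∎
  where
  open ≡-Reasoning
  shift : ∀ a b c d → (a + b) + c * suc d ≡ (a + c) + (b + c * d)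
  shift = solve-∀
padded-+-* p (outside ∷ W) (x ∷ v) = begin
  (p + padded p W v) + p * ∣ W ∣          ≡⟨ +-assoc p _ _ ⟩
  p + (padded p W v + p * ∣ W ∣)          ≡⟨ cong (p +_) (padded-+-* p W v) ⟩
  p + (sumOver W v + p * _)               ≡⟨ shift (sumOver W v) p _ ⟩
  sumOver W v + p * suc _                 ∎
  where
  open ≡-Reasoning
  shift : ∀ a b c → b + (a + b * c) ≡ a + b * suc c
  shift = solve-∀

-- padded p W v differs from sumOver W v by p * (m ∸ ∣ W ∣), is bounded below by cappedSum p v,
-- and meets that bound on threshold sets.
threshold⇒minimal : ∀ {p} {W : Subset m} {v} → Threshold p W v → Minimal v W
threshold⇒minimal {m} {p} {W} {v} thW T |T| = +-cancelʳ-≤ (p * m) _ _ (begin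
  sumOver W v + p * m        ≡⟨ sym (padded-+-* p W v) ⟩
  padded p W v + p * ∣ W ∣   ≡⟨ cong (_+ p * ∣ W ∣) (threshold⇒padded≡cappedSum thW) ⟩
  cappedSum p v + p * ∣ W ∣  ≤⟨ +-monoˡ-≤ _ (cappedSum≤padded p T v) ⟩
  padded p T v + p * ∣ W ∣   ≡⟨ cong (λ k → padded p T v + p * k) (sym |T|) ⟩
  padded p T v + p * ∣ T ∣   ≡⟨ padded-+-* p T v ⟩
  sumOver T v + p * m        ∎)
  where open ≤-Reasoning

sumOver-[]≔ : (S : Subset m) (v : Vec ℕ m) (t : Fin m) →
  sumOver (S [ t ]≔ inside) v ≡ sumOver (S [ t ]≔ outside) v + lookup v t
sumOver-[]≔ (_ ∷ S)       (x ∷ v) zero    = +-comm x _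
sumOver-[]≔ (inside ∷ S)  (x ∷ v) (suc t) =
  trans (cong (x +_) (sumOver-[]≔ S v t)) (sym (+-assoc x _ _))
sumOver-[]≔ (outside ∷ S) (x ∷ v) (suc t) = sumOver-[]≔ S v t

∣[]≔inside∣ : (S : Subset m) (t : Fin m) → ∣ S [ t ]≔ inside ∣ ≡ suc ∣ S [ t ]≔ outside ∣
∣[]≔inside∣ (_ ∷ S)       zero    = refl
∣[]≔inside∣ (inside ∷ S)  (suc t) = cong suc (∣[]≔inside∣ S t)
∣[]≔inside∣ (outside ∷ S) (suc t) = ∣[]≔inside∣ S t

minimal-exchange : ∀ {v : Vec ℕ m} S → Minimal v S → ∀ {t u} →
  lookup S t ≡ inside → lookup S u ≡ outside → lookup v t ≤ lookup v u
minimal-exchange {v = v} S min {t} {u} t∈S u∉S = +-cancelˡ-≤ (sumOver S⁻ v) _ _ (begin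
  sumOver S⁻ v + lookup v t                   ≡⟨ sym (sumOver-[]≔ S v t) ⟩
  sumOver (S [ t ]≔ inside) v                 ≡⟨ cong (λ W → sumOver W v) S-unchanged ⟩
  sumOver S v                                 ≤⟨ min T |T| ⟩
  sumOver T v                                 ≡⟨ sumOver-[]≔ S⁻ v u ⟩
  sumOver (S⁻ [ u ]≔ outside) v + lookup v u  ≡⟨ cong (λ W → sumOver W v + lookup v u) S⁻-unchanged ⟩
  sumOver S⁻ v + lookup v u                   ∎)
  where
  open ≤-Reasoning
  S⁻ = S [ t ]≔ outside
  T = S⁻ [ u ]≔ inside
  u≢t : u ≢ t
  u≢t refl with trans (sym t∈S) u∉S
  ... | ()
  S-unchanged : S [ t ]≔ inside ≡ S
  S-unchanged = trans (cong (S [ t ]≔_) (sym t∈S)) ([]≔-lookup S t)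
  S⁻-unchanged : S⁻ [ u ]≔ outside ≡ S⁻
  S⁻-unchanged = trans (cong (S⁻ [ u ]≔_) (sym (trans (lookup∘update′ u≢t S outside) u∉S)))
                       ([]≔-lookup S⁻ u)
  |T| : ∣ T ∣ ≡ ∣ S ∣
  |T| = begin-equality
    ∣ T ∣                         ≡⟨ ∣[]≔inside∣ S⁻ u ⟩
    suc ∣ S⁻ [ u ]≔ outside ∣     ≡⟨ cong (suc ∘ ∣_∣) S⁻-unchanged ⟩
    suc ∣ S⁻ ∣                    ≡⟨ sym (∣[]≔inside∣ S t) ⟩
    ∣ S [ t ]≔ inside ∣           ≡⟨ cong ∣_∣ S-unchanged ⟩
    ∣ S ∣                         ∎

maxOver : Subset m → Vec ℕ m → ℕ
maxOver []            []      = 0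
maxOver (inside ∷ S)  (x ∷ v) = x ⊔ maxOver S v
maxOver (outside ∷ S) (x ∷ v) = maxOver S v

maxOver-upper : ∀ (S : Subset m) v t → lookup S t ≡ inside → lookup v t ≤ maxOver S v
maxOver-upper (inside ∷ S)  (x ∷ v) zero    _   = m≤m⊔n x _
maxOver-upper (inside ∷ S)  (x ∷ v) (suc t) t∈S = ≤-trans (maxOver-upper S v t t∈S) (m≤n⊔m x _)
maxOver-upper (outside ∷ S) (x ∷ v) (suc t) t∈S = maxOver-upper S v t t∈S

maxOver-least : ∀ (S : Subset m) v {c} → (∀ t → lookup S t ≡ inside → lookup v t ≤ c) → maxOver S v ≤ c
maxOver-least []            []      _ = z≤n
maxOver-least (inside ∷ S)  (x ∷ v) h = ⊔-lub (h zero refl) (maxOver-least S v (h ∘ suc))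
maxOver-least (outside ∷ S) (x ∷ v) h = maxOver-least S v (h ∘ suc)

minimal⇒threshold : ∀ {v : Vec ℕ m} S → Minimal v S → Threshold (maxOver S v) S v
minimal⇒threshold {v = v} S min = lookup⇒threshold (maxOver-upper S v)
  (λ u u∉S → maxOver-least S v (λ t t∈S → minimal-exchange S min t∈S u∉S))

minimal-++ : ∀ {y : Vec ℕ m} (S : Subset m) (z : Vec ℕ n) → Minimal y S →
  Minimal (y ++ z) (S ++ atMost (maxOver S y) z)
minimal-++ S z min = threshold⇒minimal (threshold-++ (minimal⇒threshold S min) (threshold-atMost _ z))

minSum-++-mono : ∀ {x y : Vec ℕ s} (z : Vec ℕ t) →
  (∀ ℓ → 1 ≤ ℓ → ℓ ≤ s → minSum ℓ x ≤ minSum ℓ y) →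
  ∀ ℓ → ℓ ≤ s + t → minSum ℓ (x ++ z) ≤ minSum ℓ (y ++ z)
minSum-++-mono {s} {x = x} {y} z x≤y ℓ ℓ≤ with minSum-attained (y ++ z) ℓ≤
... | W , |W| , eqW with splitAt s W
... | W₁ , W₂ , refl with minSum-attained x (∣p∣≤n W₁)
... | S , |S| , eqS = begin
  minSum ℓ (x ++ z)                ≤⟨ minSum-≤ (S ++ W₂) (x ++ z) (trans (∣++∣-congʳ S W₁ W₂ |S|) |W|) ⟩
  sumOver (S ++ W₂) (x ++ z)       ≡⟨ sumOver-++ S W₂ x z ⟩
  sumOver S x + sumOver W₂ z       ≡⟨ cong (_+ sumOver W₂ z) (sym eqS) ⟩
  minSum (∣ W₁ ∣) x + sumOver W₂ z ≤⟨ +-monoˡ-≤ _ (x≤y₀ ∣ W₁ ∣ (∣p∣≤n W₁)) ⟩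
  minSum (∣ W₁ ∣) y + sumOver W₂ z ≤⟨ +-monoˡ-≤ _ (minSum-≤ W₁ y refl) ⟩
  sumOver W₁ y + sumOver W₂ z      ≡⟨ sym (sumOver-++ W₁ W₂ y z) ⟩
  sumOver (W₁ ++ W₂) (y ++ z)      ≡⟨ sym eqW ⟩
  minSum ℓ (y ++ z)                ∎
  where
  open ≤-Reasoning
  x≤y₀ : ∀ ℓ → ℓ ≤ s → minSum ℓ x ≤ minSum ℓ y
  x≤y₀ zero    _ = ≤-reflexive (trans (minSum-zero x) (sym (minSum-zero y)))
  x≤y₀ (suc ℓ)   = x≤y (suc ℓ) (s≤s z≤n)

minSum-++-cancelʳ : ∀ {x y : Vec ℕ s} (z : Vec ℕ t) →
  (∀ ℓ → 1 ≤ ℓ → ℓ ≤ s + t → minSum ℓ (x ++ z) ≡ minSum ℓ (y ++ z)) →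
  ∀ ℓ → 1 ≤ ℓ → ℓ ≤ s → minSum ℓ y ≤ minSum ℓ x
minSum-++-cancelʳ {x = x} {y} z x≡y ℓ 1≤ℓ ℓ≤s with minimal-ofSize y ℓ≤s
... | S , refl , minS with minSum-attained x ℓ≤s
... | T , |T| , eqT = +-cancelʳ-≤ (sumOver U z) _ _ (begin
  minSum (∣ S ∣) y + sumOver U z   ≡⟨ cong (_+ sumOver U z) (minimal⇒minSum S minS) ⟩
  sumOver S y + sumOver U z      ≡⟨ sym (sumOver-++ S U y z) ⟩
  sumOver (S ++ U) (y ++ z)      ≡⟨ sym (minimal⇒minSum (S ++ U) (minimal-++ S z minS)) ⟩
  minSum (∣ S ++ U ∣) (y ++ z)     ≡⟨ sym (x≡y _ 1≤∣S++U∣ (∣p∣≤n (S ++ U))) ⟩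
  minSum (∣ S ++ U ∣) (x ++ z)     ≤⟨ minSum-≤ (T ++ U) (x ++ z) (∣++∣-congʳ T S U |T|) ⟩
  sumOver (T ++ U) (x ++ z)      ≡⟨ sumOver-++ T U x z ⟩
  sumOver T x + sumOver U z      ≡⟨ cong (_+ sumOver U z) (sym eqT) ⟩
  minSum (∣ S ∣) x + sumOver U z   ∎)
  where
  open ≤-Reasoning
  U = atMost (maxOver S y) z
  1≤∣S++U∣ : 1 ≤ ∣ S ++ U ∣
  1≤∣S++U∣ = subst (1 ≤_) (sym (∣p++q∣ S U)) (≤-trans 1≤ℓ (m≤m+n _ _))

sum-map-lookup-⊕ : (ts : List (Fin n)) (a b : Weight n) →
  sum (map (lookup (a ⊕ b)) ts) ≡ sum (map (lookup a) ts) + sum (map (lookup b) ts)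
sum-map-lookup-⊕ []       a b = refl
sum-map-lookup-⊕ (t ∷ ts) a b rewrite lookup-zipWith _+_ t a b | sum-map-lookup-⊕ ts a b =
  interchange (lookup a t) (lookup b t) _ _

sum-map-lookup-0w : (ts : List (Fin n)) → sum (map (lookup (0w {n})) ts) ≡ 0
sum-map-lookup-0w []       = refl
sum-map-lookup-0w (t ∷ ts) rewrite lookup-replicate t 0 = sum-map-lookup-0w ts

segment : Fin n → Fin n → List (Fin n)
segment i j = filter (λ t → (i ≤ᶠ? t) ×-dec (t ≤ᶠ? j)) (toList (allFin _))

segSums : Fin n → Fin n → Tuple n m → Vec ℕ m
segSums i j = vmap (segSum i j)

segSum-subsetSum : (i j : Fin n) (p : Subset m) (λs : Tuple n m) →
  segSum i j (subsetSum p λs) ≡ sumOver p (segSums i j λs)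
segSum-subsetSum i j []            []       = sum-map-lookup-0w (segment i j)
segSum-subsetSum i j (inside ∷ p)  (x ∷ λs) =
  trans (sum-map-lookup-⊕ (segment i j) x (subsetSum p λs)) (cong (segSum i j x +_) (segSum-subsetSum i j p λs))
segSum-subsetSum i j (outside ∷ p) (x ∷ λs) = segSum-subsetSum i j p λs

r≡minSum : (i j : Fin n) (ℓ : ℕ) (λs : Tuple n m) → r i j ℓ λs ≡ minSum ℓ (segSums i j λs)
r≡minSum i j ℓ λs = cong minimum (map-cong (λ p → segSum-subsetSum i j p λs) (subsetsOfSize _ ℓ))

r-++ : (i j : Fin n) (ℓ : ℕ) (λs : Tuple n s) (τs : Tuple n t) →
  r i j ℓ (λs ++ τs) ≡ minSum ℓ (segSums i j λs ++ segSums i j τs)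
r-++ i j ℓ λs τs = trans (r≡minSum i j ℓ (λs ++ τs)) (cong (minSum ℓ) (map-++ (segSum i j) λs τs))

⊴-++⁺ʳ : (λs μs : Tuple n s) (τs : Tuple n t) → λs ⊴ μs → (λs ++ τs) ⊴ (μs ++ τs)
⊴-++⁺ʳ λs μs τs λ⊴μ i j i≤j ℓ _ ℓ≤ rewrite r-++ i j ℓ λs τs | r-++ i j ℓ μs τs =
  minSum-++-mono (segSums i j τs) values≤ ℓ ℓ≤
  where
  values≤ : ∀ ℓ → 1 ≤ ℓ → ℓ ≤ _ → minSum ℓ (segSums i j λs) ≤ minSum ℓ (segSums i j μs)
  values≤ ℓ 1≤ℓ ℓ≤s = subst₂ _≤_ (r≡minSum i j ℓ λs) (r≡minSum i j ℓ μs) (λ⊴μ i j i≤j ℓ 1≤ℓ ℓ≤s)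

∼-++⁻ʳ : (λs μs : Tuple n s) (τs : Tuple n t) → (λs ++ τs) ∼ (μs ++ τs) → λs ∼ μs
∼-++⁻ʳ λs μs τs λτ∼μτ i j i≤j ℓ 1≤ℓ ℓ≤s rewrite r≡minSum i j ℓ λs | r≡minSum i j ℓ μs =
  ≤-antisym (minSum-++-cancelʳ z (λ ℓ 1≤ℓ ℓ≤ → sym (values≡ ℓ 1≤ℓ ℓ≤)) ℓ 1≤ℓ ℓ≤s)
            (minSum-++-cancelʳ z values≡ ℓ 1≤ℓ ℓ≤s)
  where
  z = segSums i j τs
  values≡ : ∀ ℓ → 1 ≤ ℓ → ℓ ≤ _ → minSum ℓ (segSums i j λs ++ z) ≡ minSum ℓ (segSums i j μs ++ z)
  values≡ ℓ 1≤ℓ ℓ≤ = subst₂ _≡_ (r-++ i j ℓ λs τs) (r-++ i j ℓ μs τs) (λτ∼μτ i j i≤j ℓ 1≤ℓ ℓ≤)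

◁-++⁺ʳ : (λs μs : Tuple n s) (τs : Tuple n t) → λs ◁ μs → (λs ++ τs) ◁ (μs ++ τs)
◁-++⁺ʳ λs μs τs (λ⊴μ , λ≁μ) = ⊴-++⁺ʳ λs μs τs λ⊴μ , λ≁μ ∘ ∼-++⁻ʳ λs μs τs

tsum-++ : (λs : Tuple n s) (τs : Tuple n t) → tsum (λs ++ τs) ≡ tsum λs ⊕ tsum τs
tsum-++ []       τs = sym (zipWith-identityˡ +-identityˡ (tsum τs))
tsum-++ (x ∷ λs) τs =
  trans (cong (x ⊕_) (tsum-++ λs τs)) (sym (zipWith-assoc +-assoc x (tsum λs) (tsum τs)))

InP-++ : ∀ {μ τ : Weight n} (λs : Tuple n s) (τs : Tuple n t) →
  InP μ λs → InP τ τs → InP (μ ⊕ τ) (λs ++ τs)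
InP-++ λs τs refl refl = tsum-++ λs τs

proposition3p4 : (n : ℕ) (μ τ : Weight n) (s k : ℕ) → 1 ≤ s → s < k →
    (λs μs : Tuple n s) (τs : Tuple n (k ∸ s)) →
    InP μ λs → InP μ μs → InP τ τs → λs ◁ μs →
    InP (μ ⊕ τ) (λs ++ τs) × InP (μ ⊕ τ) (μs ++ τs) × ((λs ++ τs) ◁ (μs ++ τs))
proposition3p4 n μ τ s k _ _ λs μs τs λs∈ μs∈ τs∈ λ◁μ =
  InP-++ λs τs λs∈ τs∈ , InP-++ μs τs μs∈ τs∈ , ◁-++⁺ʳ λs μs τs λ◁μ
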